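{- Let $A$ be a finite or countable alphabet with $|A|\ge2$, let $\theta$ be a literal (anti)morphism onto $A^*$, and let $X\subseteq A^*$ be a $\theta$-invariant code which is not complete. Let $y\in A^*\setminus F(X^*)$ with $|y|\ge 2$ whose initial letter $a$ and terminal letter $\overline a$ are different. Set $z=\overline a^{\,|y|}\,y\,a^{|y|}$ and $Z=\{\theta^i(z)\mid i\in\mathbb{Z}\}$. Then $A^+ZA^+\cap ZX^*Z=\emptyset$.
   Context: $A^*$ is the free monoid over $A$, $A^+=A^*\setminus\{\varepsilon\}$. Standing assumption: $\theta:A^*\to A^*$ is a bijection, literal ($\theta(A)\subseteq A$), and either a morphism or an antimorphism ($\theta(\varepsilon)=\varepsilon$, $\theta(xy)=\theta(y)\theta(x)$); $\theta^i$ ($i\in\mathbb{Z}$) are its iterates. $X$ is $\theta$-invariant if $\theta(X)=X$. A code is a set $X$ such that any equation $x_1\cdots x_m=y_1\cdots y_n$ with $x_i,y_j\in X$ forces $m=n$ and $x_i=y_i$ for all $i$. $F(S)$ is the set of factors of words of $S$ ($w$ is a factor of $s$ if $s=uwv$ for some words $u,v$). $X$ is complete if $F(X^*)=A^*$. -}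

module Defs where

open import Data.Nat using (ℕ; zero; suc; _≥_)
open import Data.List using (List; []; _∷_; _++_; concat; length; replicate; head; last; [_])
open import Data.List.Relation.Unary.All using (All)
open import Data.Maybe using (just)
open import Data.Product using (Σ; ∃; _×_; _,_)
open import Data.Sum using (_⊎_)
open import Relation.Nullary using (¬_)
open import Relation.Binary.PropositionalEquality using (_≡_; _≢_)
open import Function.Definitions using (Injective; Bijective)

Lang : Set → Set₁
Lang A = List A → Set

-- A is finite or countable: it injects into ℕ.
Countable : Set → Set
Countable A = Σ (A → ℕ) λ f → Injective _≡_ _≡_ f

AtLeastTwo : Set → Set
AtLeastTwo A = Σ A λ a → Σ A λ b → a ≢ b

Literal : {A : Set} → (List A → List A) → Set
Literal {A} θ = ∀ (a : A) → ∃ λ b → θ [ a ] ≡ [ b ]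

IsMorphism : {A : Set} → (List A → List A) → Set
IsMorphism {A} θ = (θ [] ≡ []) × (∀ (u v : List A) → θ (u ++ v) ≡ θ u ++ θ v)

IsAntimorphism : {A : Set} → (List A → List A) → Set
IsAntimorphism {A} θ = (θ [] ≡ []) × (∀ (u v : List A) → θ (u ++ v) ≡ θ v ++ θ u)

LiteralBijectiveAntiMorphism : {A : Set} → (List A → List A) → Set
LiteralBijectiveAntiMorphism θ =
  Bijective _≡_ _≡_ θ × Literal θ × (IsMorphism θ ⊎ IsAntimorphism θ)

iter : {A : Set} → (List A → List A) → ℕ → List A → List A
iter θ zero w = w
iter θ (suc n) w = θ (iter θ n w)

Invariant : {A : Set} → (List A → List A) → Lang A → Set
Invariant θ X = (∀ w → X w → X (θ w)) × (∀ w → X w → ∃ λ v → X v × θ v ≡ w)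

Star : {A : Set} → Lang A → Lang A
Star X w = ∃ λ xs → All X xs × concat xs ≡ w

IsCode : {A : Set} → Lang A → Set
IsCode X = ∀ xs ys → All X xs → All X ys → concat xs ≡ concat ys → xs ≡ ys

Factors : {A : Set} → Lang A → Lang A
Factors S w = ∃ λ s → ∃ λ u → ∃ λ v → S s × u ++ w ++ v ≡ s

Complete : {A : Set} → Lang A → Set
Complete X = ∀ w → Factors (Star X) w

-- Z = { θ^i(z) | i ∈ ℤ }: w = θ^n(z) (i = n ≥ 0) or θ^n(w) = z (i = -n ≤ 0)
Orbit : {A : Set} → (List A → List A) → List A → Lang A
Orbit θ z w = ∃ λ n → (iter θ n z ≡ w) ⊎ (iter θ n w ≡ z)

PlusSurround : {A : Set} → Lang A → Lang A
PlusSurround S w = ∃ λ u → ∃ λ s → ∃ λ v → u ≢ [] × v ≢ [] × S s × w ≡ u ++ s ++ v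

Sandwich : {A : Set} → Lang A → Lang A → Lang A
Sandwich S X w = ∃ λ s₁ → ∃ λ x → ∃ λ s₂ → S s₁ × Star X x × S s₂ × w ≡ s₁ ++ x ++ s₂

-- Every θ^i(z) has the form pⁿ (q M p) qⁿ with p ≠ q, n = |q M p| = |y|, and q M p ∉ F(X*):
-- a literal (anti)morphism maps this shape to itself (an antimorphism swaps p and q), and
-- θ and θ⁻¹ both preserve F(X*) because θ(X) = X.  Now let u s v = s₁ x s₂ with u, v ≠ ε,
-- s, s₁, s₂ ∈ Z, all of length 3n.  If |u| < 2n, then s overlaps s₁ at a shift in [1, 2n),
-- which forces some p of one word to equal a q of the other; |v| < 2n is the mirror image.
-- Otherwise the core q M p of s lies inside x ∈ X*, a contradiction.

module Submission where

open import Defs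
open import Data.Nat using (ℕ; zero; suc; _+_; _≥_; _≤_; _<_; s≤s; s≤s⁻¹; z≤n; _<?_)
open import Data.Nat.Properties
open import Data.Nat.Tactic.RingSolver using (solve-∀)
open import Data.List using (List; []; _∷_; _++_; _∷ʳ_; length; replicate; reverse; head; last; [_]; concat)
open import Data.List.Properties
  using (++-assoc; ++-identityʳ; length-++; length-replicate; length-reverse; reverse-++; reverse-involutive; unfold-reverse; concat-++; ∷-injective; ∷-injectiveˡ)
open import Data.List.Relation.Unary.All using (All; []; _∷_)
open import Data.List.Relation.Unary.All.Properties using (++⁺)
open import Data.Maybe using (Maybe; just; nothing)
open import Data.Maybe.Properties using (just-injective)
open import Data.Product using (Σ-syntax; ∃; ∃₂; _×_; _,_; proj₁; proj₂)
open import Data.Sum using (_⊎_; inj₁; inj₂; [_,_]′)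
open import Data.Empty using (⊥)
open import Relation.Nullary using (¬_; yes; no)
open import Relation.Binary.PropositionalEquality hiding ([_])
open import Relation.Binary.Definitions using (tri<; tri≈; tri>)
open import Function.Base using (_∘_; case_of_)
open import Function.Definitions using (Injective; Surjective)

module _ {A : Set} where

  infix 4.5 _‼_

  _‼_ : List A → ℕ → Maybe A
  []       ‼ _     = nothing
  (x ∷ xs) ‼ zero  = just x
  (x ∷ xs) ‼ suc j = xs ‼ j

  ‼-++ˡ : ∀ (xs ys : List A) {j} → j < length xs → (xs ++ ys) ‼ j ≡ xs ‼ j
  ‼-++ˡ (x ∷ xs) ys {zero}  _         = refl
  ‼-++ˡ (x ∷ xs) ys {suc j} (s≤s j<n) = ‼-++ˡ xs ys j<n

  ‼-++ʳ : ∀ (xs ys : List A) {i} j → length xs + j ≡ i → (xs ++ ys) ‼ i ≡ ys ‼ j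
  ‼-++ʳ []       ys j refl = refl
  ‼-++ʳ (x ∷ xs) ys j refl = ‼-++ʳ xs ys j refl

  ‼-replicate : ∀ n (x : A) {j} → j < n → replicate n x ‼ j ≡ just x
  ‼-replicate (suc n) x {zero}  _         = refl
  ‼-replicate (suc n) x {suc j} (s≤s j<n) = ‼-replicate n x j<n

  ‼≡just⇒< : ∀ (xs : List A) {j b} → xs ‼ j ≡ just b → j < length xs
  ‼≡just⇒< (x ∷ xs) {zero}  _ = s≤s z≤n
  ‼≡just⇒< (x ∷ xs) {suc j} e = s≤s (‼≡just⇒< xs e)

  replicate-∷ʳ : ∀ n (x : A) → replicate n x ∷ʳ x ≡ x ∷ replicate n x
  replicate-∷ʳ zero    x = refl
  replicate-∷ʳ (suc n) x = cong (x ∷_) (replicate-∷ʳ n x)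

  reverse-replicate : ∀ n (x : A) → reverse (replicate n x) ≡ replicate n x
  reverse-replicate zero    x = refl
  reverse-replicate (suc n) x = begin
    reverse (x ∷ replicate n x)  ≡⟨ unfold-reverse x (replicate n x) ⟩
    reverse (replicate n x) ∷ʳ x ≡⟨ cong (_∷ʳ x) (reverse-replicate n x) ⟩
    replicate n x ∷ʳ x           ≡⟨ replicate-∷ʳ n x ⟩
    x ∷ replicate n x            ∎
    where open ≡-Reasoning

  reverse-++₃ : ∀ (a b c : List A) → reverse (a ++ b ++ c) ≡ reverse c ++ reverse b ++ reverse a
  reverse-++₃ a b c = begin
    reverse (a ++ b ++ c)                  ≡⟨ reverse-++ a (b ++ c) ⟩
    reverse (b ++ c) ++ reverse a          ≡⟨ cong (_++ reverse a) (reverse-++ b c) ⟩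
    (reverse c ++ reverse b) ++ reverse a  ≡⟨ ++-assoc (reverse c) (reverse b) (reverse a) ⟩
    reverse c ++ reverse b ++ reverse a    ∎
    where open ≡-Reasoning

  ++-split : ∀ (a r b r′ : List A) → a ++ r ≡ b ++ r′ → length a ≤ length b →
             ∃ λ c → b ≡ a ++ c × r ≡ c ++ r′
  ++-split []      r b       r′ e _ = b , refl , e
  ++-split (x ∷ a) r (y ∷ b) r′ e (s≤s a≤b) with ∷-injective e
  ... | refl , e′ with ++-split a r b r′ e′ a≤b
  ...   | c , refl , r≡ = c , refl , r≡

  ++-middle-infix : ∀ {a y b c x d : List A} → a ++ y ++ b ≡ c ++ x ++ d →
                    length c ≤ length a → length d ≤ length b → ∃₂ λ l r → l ++ y ++ r ≡ x
  ++-middle-infix {a} {y} {b} {c} {x} {d} e c≤a d≤b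
    with ++-split c (x ++ d) a (y ++ b) (sym e) c≤a
  ... | a′ , refl , x++d≡ with ++-split (a′ ++ y) b x d (trans (++-assoc a′ y b) (sym x++d≡)) a′y≤x
    where
    a′y≤x : length (a′ ++ y) ≤ length x
    a′y≤x = +-cancelʳ-≤ (length b) (length (a′ ++ y)) (length x) (begin
      length (a′ ++ y) + length b ≡⟨ length-++ (a′ ++ y) ⟨
      length ((a′ ++ y) ++ b)     ≡⟨ cong length (trans (++-assoc a′ y b) (sym x++d≡)) ⟩
      length (x ++ d)             ≡⟨ length-++ x ⟩
      length x + length d         ≤⟨ +-monoʳ-≤ (length x) d≤b ⟩
      length x + length b         ∎)
      where open ≤-Reasoning
  ...   | r , x≡ , _ = a′ , r , sym (trans x≡ (++-assoc a′ y r))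

  ++-regroup : ∀ (u a c b v : List A) → u ++ (a ++ c ++ b) ++ v ≡ (u ++ a) ++ c ++ b ++ v
  ++-regroup u a c b v = begin
    u ++ (a ++ c ++ b) ++ v    ≡⟨ cong (u ++_) (++-assoc a (c ++ b) v) ⟩
    u ++ a ++ (c ++ b) ++ v    ≡⟨ cong (λ t → u ++ a ++ t) (++-assoc c b v) ⟩
    u ++ a ++ c ++ b ++ v      ≡⟨ ++-assoc u a (c ++ b ++ v) ⟨
    (u ++ a) ++ c ++ b ++ v    ∎
    where open ≡-Reasoning

  last≡just⇒∷ʳ : ∀ (x : A) xs {l} → last (x ∷ xs) ≡ just l →
                 ∃ λ M → x ∷ xs ≡ M ∷ʳ l × length M ≡ length xs
  last≡just⇒∷ʳ x []       refl = [] , refl , refl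
  last≡just⇒∷ʳ x (y ∷ xs) e with last≡just⇒∷ʳ y xs e
  ... | M , y∷xs≡ , |M| = x ∷ M , cong (x ∷_) y∷xs≡ , cong suc |M|

  -- padded |y| ā a M is the paper's z = ā^|y| y a^|y| for y = a M ā.
  padded : ℕ → A → A → List A → List A
  padded n p q M = replicate n p ++ (q ∷ M ++ [ p ]) ++ replicate n q

  record Padded (m : ℕ) (s : List A) : Set where
    field
      p q      : A
      M        : List A
      p≢q      : p ≢ q
      length-M : length M ≡ m
      s≡       : s ≡ padded (2 + m) p q M

    core : List A
    core = q ∷ M ++ [ p ]

  PaddedNonFactor : Lang A → ℕ → List A → Set
  PaddedNonFactor X m s = Σ[ P ∈ Padded m s ] ¬ Factors (Star X) (Padded.core P)

  module _ {m s} (P : Padded m s) where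
    open Padded P

    private
      n : ℕ
      n = 2 + m

      length-core : length core ≡ n
      length-core = cong suc (trans (length-++ M) (trans (cong (_+ 1) length-M) (+-comm m 1)))

      ‼-s : ∀ j → s ‼ j ≡ padded n p q M ‼ j
      ‼-s j = cong (_‼ j) s≡

    length-Padded : length s ≡ n + (n + n)
    length-Padded = trans (cong length s≡) (trans (length-++ (replicate n p))
      (cong₂ _+_ (length-replicate n) (trans (length-++ core) (cong₂ _+_ length-core (length-replicate n)))))

    Padded-‼-left : ∀ {j} → j < n → s ‼ j ≡ just p
    Padded-‼-left {j} j<n = trans (‼-s j)
      (trans (‼-++ˡ (replicate n p) _ (subst (j <_) (sym (length-replicate n)) j<n)) (‼-replicate n p j<n))

    Padded-‼-core-head : s ‼ n ≡ just q
    Padded-‼-core-head = trans (‼-s n)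
      (‼-++ʳ (replicate n p) _ 0 (trans (cong (_+ 0) (length-replicate n)) (+-identityʳ n)))

    Padded-‼-core-last : s ‼ (n + suc m) ≡ just p
    Padded-‼-core-last = begin
      s ‼ (n + suc m)                          ≡⟨ ‼-s (n + suc m) ⟩
      padded n p q M ‼ (n + suc m)             ≡⟨ ‼-++ʳ (replicate n p) _ (suc m) (cong (_+ suc m) (length-replicate n)) ⟩
      (M ++ [ p ]) ++ replicate n q ‼ m        ≡⟨ cong (_‼ m) (++-assoc M [ p ] (replicate n q)) ⟩
      M ++ [ p ] ++ replicate n q ‼ m          ≡⟨ ‼-++ʳ M _ 0 (trans (+-identityʳ (length M)) length-M) ⟩
      just p                                   ∎
      where open ≡-Reasoning

    Padded-‼-right : ∀ {j} → j < n → s ‼ (n + (n + j)) ≡ just q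
    Padded-‼-right {j} j<n = trans (‼-s (n + (n + j)))
      (trans (‼-++ʳ (replicate n p) _ (n + j) (cong (_+ (n + j)) (length-replicate n)))
      (trans (‼-++ʳ core (replicate n q) j (cong (_+ j) length-core)) (‼-replicate n q j<n)))

    reverse-Padded : Padded m (reverse s)
    reverse-Padded = record
      { p = q ; q = p ; M = reverse M ; p≢q = p≢q ∘ sym
      ; length-M = trans (length-reverse M) length-M
      ; s≡ = begin
          reverse s                                                          ≡⟨ cong reverse s≡ ⟩
          reverse (replicate n p ++ core ++ replicate n q)                   ≡⟨ reverse-++₃ (replicate n p) core (replicate n q) ⟩
          reverse (replicate n q) ++ reverse core ++ reverse (replicate n p) ≡⟨ cong₂ _++_ (reverse-replicate n q)
                                                                                 (cong₂ _++_ (reverse-++₃ [ q ] M [ p ]) (reverse-replicate n p)) ⟩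
          padded n q p (reverse M)                                           ∎ }
      where open ≡-Reasoning

  Padded-around : ∀ {a a̅} b rest → last (b ∷ rest) ≡ just a̅ → a ≢ a̅ →
                  let n = 2 + length rest in
                  Σ[ P ∈ Padded (length rest) (replicate n a̅ ++ (a ∷ b ∷ rest) ++ replicate n a) ]
                    Padded.core P ≡ a ∷ b ∷ rest
  Padded-around {a} {a̅} b rest last≡a̅ a≢a̅ with last≡just⇒∷ʳ b rest last≡a̅
  ... | M , b∷rest≡M∷ʳa̅ , |M|≡|rest| =
    record { p = a̅ ; q = a ; M = M ; p≢q = a≢a̅ ∘ sym ; length-M = |M|≡|rest|
           ; s≡ = cong (λ t → replicate n a̅ ++ (a ∷ t) ++ replicate n a) b∷rest≡M∷ʳa̅ } ,
    cong (a ∷_) (sym b∷rest≡M∷ʳa̅)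
    where
    n : ℕ
    n = 2 + length rest

  -- t occurs in t′ at offset k, possibly running past the end of t′.
  Overlap : List A → List A → ℕ → Set
  Overlap t t′ k = ∀ j {b} → t′ ‼ k + j ≡ just b → t ‼ j ≡ just b

  overlap-letter : ∀ {t t′ k} → Overlap t t′ k → ∀ j {i a b} → k + j ≡ i →
                   t ‼ j ≡ just a → t′ ‼ i ≡ just b → a ≡ b
  overlap-letter agree j refl t[j] t′[i] = just-injective (trans (sym t[j]) (agree j t′[i]))

  Padded-short-overlap : ∀ {m t t′ k} (P : Padded m t) (P′ : Padded m t′) →
                         Overlap t t′ (suc k) → suc k ≤ 2 + m → Padded.p P ≡ Padded.q P′
  Padded-short-overlap {m} {t} {t′} {k} P P′ agree 1+k≤n =
    overlap-letter {t} {t′} agree (2 + m + suc m) (index m k) (Padded-‼-core-last P) (Padded-‼-right P′ 1+k≤n)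
    where
    index : ∀ m k → suc k + (2 + m + suc m) ≡ 2 + m + (2 + m + k)
    index = solve-∀

  Padded-no-long-overlap : ∀ {d e t t′} → Padded (d + e) t → Padded (d + e) t′ →
                           ¬ Overlap t t′ (suc (2 + (d + e) + d))
  Padded-no-long-overlap {d} {e} {t} {t′} P P′ agree = Padded.p≢q P′ (trans (sym p≡p′) p≡q′)
    where
    1+e<n : suc e < 2 + (d + e)
    1+e<n = s≤s (s≤s (m≤n+m e d))
    p≡p′ : Padded.p P ≡ Padded.p P′
    p≡p′ = overlap-letter {t} {t′} agree e (index₁ d e) (Padded-‼-left P (<⇒≤ 1+e<n)) (Padded-‼-core-last P′)
      where
      index₁ : ∀ d e → suc (2 + (d + e) + d) + e ≡ 2 + (d + e) + suc (d + e)
      index₁ = solve-∀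
    p≡q′ : Padded.p P ≡ Padded.q P′
    p≡q′ = overlap-letter {t} {t′} agree (suc e) (index₂ d e) (Padded-‼-left P 1+e<n) (Padded-‼-right P′ (s≤s z≤n))
      where
      index₂ : ∀ d e → suc (2 + (d + e) + d) + suc e ≡ 2 + (d + e) + (2 + (d + e) + 0)
      index₂ = solve-∀

  -- For a shift k ≤ n the last letter p of t's core lands in the q′ⁿ block of t′, while the first
  -- letter p of t lands in the p′ⁿ block (k < n), or the first letter q of t's core lands on q′
  -- (k = n).  For n < k < 2n two consecutive p's of t land on the p′ ending t′'s core and the q′
  -- following it.
  Padded-no-overlap : ∀ {m t t′} → Padded m t → Padded m t′ →
                      ∀ k → suc k < (2 + m) + (2 + m) → ¬ Overlap t t′ (suc k)
  Padded-no-overlap {m} {t} {t′} P P′ k 1+k<2n agree with <-cmp (suc k) (2 + m)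
  ... | tri< 1+k<n _ _ = Padded.p≢q P′ (trans (sym p≡p′) (Padded-short-overlap P P′ agree (<⇒≤ 1+k<n)))
    where
    p≡p′ : Padded.p P ≡ Padded.p P′
    p≡p′ = overlap-letter {t} {t′} agree 0 (+-identityʳ (suc k)) (Padded-‼-left P (s≤s z≤n)) (Padded-‼-left P′ 1+k<n)
  ... | tri≈ _ refl _ = Padded.p≢q P (trans (Padded-short-overlap P P′ agree ≤-refl) (sym q≡q′))
    where
    q≡q′ : Padded.q P ≡ Padded.q P′
    q≡q′ = overlap-letter {t} {t′} agree (2 + m) (cong (2 + m +_) (sym (+-identityʳ (2 + m))))
             (Padded-‼-core-head P) (Padded-‼-right P′ (s≤s z≤n))
  ... | tri> _ _ n<1+k with m≤n⇒∃[o]m+o≡n (s≤s⁻¹ n<1+k)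
  ...   | d , refl with m≤n⇒∃[o]m+o≡n (d≤m m d 1+k<2n)
    where
    d≤m : ∀ m d → suc (suc (2 + m + d)) ≤ 2 + m + (2 + m) → d ≤ m
    d≤m m d h = s≤s⁻¹ (s≤s⁻¹ (+-cancelˡ-≤ (2 + m) (2 + d) (2 + m) (subst (_≤ 2 + m + (2 + m)) (index m d) h)))
      where
      index : ∀ m d → suc (suc (2 + m + d)) ≡ 2 + m + (2 + d)
      index = solve-∀
  ...     | e , refl = Padded-no-long-overlap {d} {e} P P′ agree

  Padded-no-prefix-overlap : ∀ {m s s₁ u v r} → Padded m s → Padded m s₁ →
                             u ≢ [] → length u < (2 + m) + (2 + m) → u ++ s ++ v ≡ s₁ ++ r → ⊥
  Padded-no-prefix-overlap {u = []} _ _ u≢[] _ _ = u≢[] refl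
  Padded-no-prefix-overlap {s = s} {s₁} {u@(_ ∷ u′)} {v} {r} P P₁ _ short e =
    Padded-no-overlap P P₁ (length u′) short agree
    where
    agree : Overlap s s₁ (length u)
    agree j {b} s₁[i] = begin
      s ‼ j                       ≡⟨ ‼-++ˡ s v j<|s| ⟨
      s ++ v ‼ j                  ≡⟨ ‼-++ʳ u (s ++ v) j refl ⟨
      u ++ s ++ v ‼ length u + j  ≡⟨ cong (_‼ length u + j) e ⟩
      s₁ ++ r ‼ length u + j      ≡⟨ ‼-++ˡ s₁ r i<|s₁| ⟩
      s₁ ‼ length u + j           ≡⟨ s₁[i] ⟩
      just b                      ∎
      where
      open ≡-Reasoning
      i<|s₁| : length u + j < length s₁
      i<|s₁| = ‼≡just⇒< s₁ s₁[i]
      j<|s| : j < length s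
      j<|s| = subst (j <_) (trans (length-Padded P₁) (sym (length-Padded P)))
                (≤-<-trans (m≤n+m j (length u)) i<|s₁|)

  Padded-core-infix : ∀ {m s s₁ s₂ u v x} (P : Padded m s) → Padded m s₁ → Padded m s₂ →
                      (2 + m) + (2 + m) ≤ length u → (2 + m) + (2 + m) ≤ length v →
                      u ++ s ++ v ≡ s₁ ++ x ++ s₂ → ∃₂ λ l r → l ++ Padded.core P ++ r ≡ x
  Padded-core-infix {m} {s} {s₁} {s₂} {u} {v} P P₁ P₂ long-u long-v e =
    ++-middle-infix {c = s₁} {d = s₂} e′ |s₁|≤ |s₂|≤
    where
    open Padded P
    open ≤-Reasoning
    n : ℕ
    n = 2 + m
    e′ : (u ++ replicate n p) ++ core ++ replicate n q ++ v ≡ s₁ ++ _ ++ s₂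
    e′ = trans (sym (++-regroup u (replicate n p) core (replicate n q) v)) (trans (cong (λ t → u ++ t ++ v) (sym s≡)) e)
    |s₁|≤ : length s₁ ≤ length (u ++ replicate n p)
    |s₁|≤ = begin
      length s₁                        ≡⟨ length-Padded P₁ ⟩
      n + (n + n)                      ≡⟨ +-comm n (n + n) ⟩
      (n + n) + n                      ≤⟨ +-monoˡ-≤ n long-u ⟩
      length u + n                     ≡⟨ cong (length u +_) (length-replicate n) ⟨
      length u + length (replicate n p) ≡⟨ length-++ u ⟨
      length (u ++ replicate n p)      ∎
    |s₂|≤ : length s₂ ≤ length (replicate n q ++ v)
    |s₂|≤ = begin
      length s₂                        ≡⟨ length-Padded P₂ ⟩
      n + (n + n)                      ≤⟨ +-monoʳ-≤ n long-v ⟩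
      n + length v                     ≡⟨ cong (_+ length v) (length-replicate n) ⟨
      length (replicate n q) + length v ≡⟨ length-++ (replicate n q) ⟨
      length (replicate n q ++ v)      ∎

  module _ (X : Lang A) where

    Star-[] : Star X []
    Star-[] = [] , [] , refl

    Star-++ : ∀ {a b} → Star X a → Star X b → Star X (a ++ b)
    Star-++ (xs , xs∈X , refl) (ys , ys∈X , refl) = xs ++ ys , ++⁺ xs∈X ys∈X , sym (concat-++ xs ys)

    Star-singleton : ∀ {x} → X x → Star X x
    Star-singleton {x} x∈X = [ x ] , x∈X ∷ [] , ++-identityʳ x

    PaddedNonFactor-no-sandwich : ∀ {m s s₁ s₂ u v x} → PaddedNonFactor X m s → Padded m s₁ → Padded m s₂ →
                                  u ≢ [] → v ≢ [] → Star X x → u ++ s ++ v ≡ s₁ ++ x ++ s₂ → ⊥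
    PaddedNonFactor-no-sandwich {m} {s} {s₁} {s₂} {u} {v} {x} (P , core∉F) P₁ P₂ u≢[] v≢[] x∈X* e
      with length u <? (2 + m) + (2 + m) | length v <? (2 + m) + (2 + m)
    ... | yes short-u | _ = Padded-no-prefix-overlap P P₁ u≢[] short-u e
    ... | no _ | yes short-v =
      Padded-no-prefix-overlap (reverse-Padded P) (reverse-Padded P₂) reverse-v≢[]
        (subst (_< _) (sym (length-reverse v)) short-v) e′
      where
      reverse-v≢[] : reverse v ≢ []
      reverse-v≢[] rv≡[] = v≢[] (trans (sym (reverse-involutive v)) (cong reverse rv≡[]))
      e′ : reverse v ++ reverse s ++ reverse u ≡ reverse s₂ ++ reverse x ++ reverse s₁
      e′ = trans (sym (reverse-++₃ u s v)) (trans (cong reverse e) (reverse-++₃ s₁ x s₂))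
    ... | no long-u | no long-v =
      let l , r , l++core++r≡x = Padded-core-infix {u = u} {v} P P₁ P₂ (≮⇒≥ long-u) (≮⇒≥ long-v) e
      in core∉F (x , l , r , x∈X* , l++core++r≡x)

module LiteralHom {A : Set} (φ : List A → List A) (φ-literal : Literal φ)
                  (φ-hom : IsMorphism φ ⊎ IsAntimorphism φ) where

  φ-[] : φ [] ≡ []
  φ-[] = [ proj₁ , proj₁ ]′ φ-hom

  letter : A → A
  letter a = proj₁ (φ-literal a)

  φ-[_] : ∀ a → φ [ a ] ≡ [ letter a ]
  φ-[ a ] = proj₂ (φ-literal a)

  letter-injective : Injective _≡_ _≡_ φ → Injective _≡_ _≡_ letter
  letter-injective φ-injective {a} {b} e = ∷-injectiveˡ (φ-injective (trans φ-[ a ] (trans (cong [_] e) (sym φ-[ b ]))))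

  morphism-++₃ : (∀ u v → φ (u ++ v) ≡ φ u ++ φ v) → ∀ a b c → φ (a ++ b ++ c) ≡ φ a ++ φ b ++ φ c
  morphism-++₃ hom a b c = trans (hom a (b ++ c)) (cong (φ a ++_) (hom b c))

  antimorphism-++₃ : (∀ u v → φ (u ++ v) ≡ φ v ++ φ u) → ∀ a b c → φ (a ++ b ++ c) ≡ φ c ++ φ b ++ φ a
  antimorphism-++₃ hom a b c =
    trans (hom a (b ++ c)) (trans (cong (_++ φ a) (hom b c)) (++-assoc (φ c) (φ b) (φ a)))

  length-φ : ∀ w → length (φ w) ≡ length w
  length-φ []      = cong length φ-[]
  length-φ (a ∷ w) = case φ-hom of λ where
    (inj₁ (_ , hom)) → trans (cong length (trans (hom [ a ] w) (cong (_++ φ w) φ-[ a ]))) (cong suc (length-φ w))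
    (inj₂ (_ , hom)) → let open ≡-Reasoning in begin
      length (φ ([ a ] ++ w))        ≡⟨ cong length (trans (hom [ a ] w) (cong (φ w ++_) φ-[ a ])) ⟩
      length (φ w ++ [ letter a ])   ≡⟨ length-++ (φ w) ⟩
      length (φ w) + 1               ≡⟨ cong (_+ 1) (length-φ w) ⟩
      length w + 1                   ≡⟨ +-comm (length w) 1 ⟩
      suc (length w)                 ∎

  φ-replicate : ∀ n a → φ (replicate n a) ≡ replicate n (letter a)
  φ-replicate zero    a = φ-[]
  φ-replicate (suc n) a = case φ-hom of λ where
    (inj₁ (_ , hom)) → trans (hom [ a ] (replicate n a)) (cong₂ _++_ φ-[ a ] (φ-replicate n a))
    (inj₂ (_ , hom)) → trans (hom [ a ] (replicate n a))
                         (trans (cong₂ _++_ (φ-replicate n a) φ-[ a ]) (replicate-∷ʳ n (letter a)))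

  φ-infix : ∀ u w v → ∃₂ λ u′ v′ → φ (u ++ w ++ v) ≡ u′ ++ φ w ++ v′
  φ-infix u w v = case φ-hom of λ where
    (inj₁ (_ , hom)) → φ u , φ v , morphism-++₃ hom u w v
    (inj₂ (_ , hom)) → φ v , φ u , antimorphism-++₃ hom u w v

  φ-padded : Injective _≡_ _≡_ φ → ∀ n p q M → p ≢ q →
             ∃₂ λ p′ q′ → p′ ≢ q′ × φ (q ∷ M ++ [ p ]) ≡ q′ ∷ φ M ++ [ p′ ] ×
                          φ (padded n p q M) ≡ padded n p′ q′ (φ M)
  φ-padded φ-injective n p q M p≢q = case φ-hom of λ where
    (inj₁ (_ , hom)) →
      let φ-core = trans (morphism-++₃ hom [ q ] M [ p ]) (cong₂ _++_ φ-[ q ] (cong (φ M ++_) φ-[ p ]))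
      in letter p , letter q , p≢q ∘ letter-injective φ-injective , φ-core ,
         trans (morphism-++₃ hom (replicate n p) _ (replicate n q))
               (cong₂ _++_ (φ-replicate n p) (cong₂ _++_ φ-core (φ-replicate n q)))
    (inj₂ (_ , hom)) →
      let φ-core = trans (antimorphism-++₃ hom [ q ] M [ p ]) (cong₂ _++_ φ-[ p ] (cong (φ M ++_) φ-[ q ]))
      in letter q , letter p , p≢q ∘ sym ∘ letter-injective φ-injective , φ-core ,
         trans (antimorphism-++₃ hom (replicate n p) _ (replicate n q))
               (cong₂ _++_ (φ-replicate n q) (cong₂ _++_ φ-core (φ-replicate n p)))

  Padded-φ : Injective _≡_ _≡_ φ → ∀ {m s} (P : Padded m s) →
             Σ[ P′ ∈ Padded m (φ s) ] Padded.core P′ ≡ φ (Padded.core P)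
  Padded-φ φ-injective {m} P with φ-padded φ-injective (2 + m) p q M p≢q
    where open Padded P
  ... | p′ , q′ , p′≢q′ , φ-core , φ-s =
    record { p = p′ ; q = q′ ; M = φ M ; p≢q = p′≢q′
           ; length-M = trans (length-φ M) length-M ; s≡ = trans (cong φ s≡) φ-s } ,
    sym φ-core
    where open Padded P

  module _ (X : Lang A) (X-closed : ∀ x → X x → X (φ x)) where

    Star-φ : ∀ {w} → Star X w → Star X (φ w)
    Star-φ (xs , xs∈X , refl) = concat-φ xs xs∈X
      where
      concat-φ : ∀ xs → All X xs → Star X (φ (concat xs))
      concat-φ []       []            = subst (Star X) (sym φ-[]) (Star-[] X)
      concat-φ (x ∷ xs) (x∈X ∷ xs∈X) = case φ-hom of λ where
        (inj₁ (_ , hom)) → subst (Star X) (sym (hom x (concat xs)))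
                             (Star-++ X (Star-singleton X (X-closed x x∈X)) (concat-φ xs xs∈X))
        (inj₂ (_ , hom)) → subst (Star X) (sym (hom x (concat xs)))
                             (Star-++ X (concat-φ xs xs∈X) (Star-singleton X (X-closed x x∈X)))

    Factors-φ : ∀ {w} → Factors (Star X) w → Factors (Star X) (φ w)
    Factors-φ {w} (s , u , v , s∈X* , u++w++v≡s) =
      let u′ , v′ , φ-uwv = φ-infix u w v
      in φ s , u′ , v′ , Star-φ s∈X* , trans (sym φ-uwv) (cong φ u++w++v≡s)

  PaddedNonFactor-φ : ∀ X → Injective _≡_ _≡_ φ → (∀ w → Factors (Star X) (φ w) → Factors (Star X) w) →
                      ∀ {m s} → PaddedNonFactor X m s → PaddedNonFactor X m (φ s)
  PaddedNonFactor-φ X φ-injective reflects (P , core∉F) =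
    let P′ , core≡ = Padded-φ φ-injective P
    in P′ , λ F → core∉F (reflects _ (subst (Factors (Star X)) core≡ F))

module BijectiveInverse {A : Set} (θ : List A → List A)
                        (θ-injective : Injective _≡_ _≡_ θ) (θ-surjective : Surjective _≡_ _≡_ θ) where

  θ⁻¹ : List A → List A
  θ⁻¹ w = proj₁ (θ-surjective w)

  θ∘θ⁻¹ : ∀ w → θ (θ⁻¹ w) ≡ w
  θ∘θ⁻¹ w = proj₂ (θ-surjective w) refl

  θ⁻¹∘θ : ∀ w → θ⁻¹ (θ w) ≡ w
  θ⁻¹∘θ w = θ-injective (θ∘θ⁻¹ (θ w))

  θ⁻¹-injective : Injective _≡_ _≡_ θ⁻¹
  θ⁻¹-injective {u} {v} e = trans (sym (θ∘θ⁻¹ u)) (trans (cong θ e) (θ∘θ⁻¹ v))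

  θ⁻¹-literal : (∀ w → length (θ w) ≡ length w) → Literal θ⁻¹
  θ⁻¹-literal length-θ b = singleton (θ⁻¹ [ b ]) (trans (sym (length-θ _)) (cong length (θ∘θ⁻¹ [ b ])))
    where
    singleton : ∀ xs → length xs ≡ 1 → ∃ λ a → xs ≡ [ a ]
    singleton []          ()
    singleton (a ∷ [])    _ = a , refl
    singleton (_ ∷ _ ∷ _) ()

  θ⁻¹-[] : θ [] ≡ [] → θ⁻¹ [] ≡ []
  θ⁻¹-[] θ-[] = θ-injective (trans (θ∘θ⁻¹ []) (sym θ-[]))

  θ⁻¹-hom : IsMorphism θ ⊎ IsAntimorphism θ → IsMorphism θ⁻¹ ⊎ IsAntimorphism θ⁻¹
  θ⁻¹-hom (inj₁ (θ-[] , hom)) = inj₁ (θ⁻¹-[] θ-[] , λ u v → θ-injective (begin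
    θ (θ⁻¹ (u ++ v))          ≡⟨ θ∘θ⁻¹ (u ++ v) ⟩
    u ++ v                    ≡⟨ cong₂ _++_ (θ∘θ⁻¹ u) (θ∘θ⁻¹ v) ⟨
    θ (θ⁻¹ u) ++ θ (θ⁻¹ v)    ≡⟨ hom (θ⁻¹ u) (θ⁻¹ v) ⟨
    θ (θ⁻¹ u ++ θ⁻¹ v)        ∎))
    where open ≡-Reasoning
  θ⁻¹-hom (inj₂ (θ-[] , hom)) = inj₂ (θ⁻¹-[] θ-[] , λ u v → θ-injective (begin
    θ (θ⁻¹ (u ++ v))          ≡⟨ θ∘θ⁻¹ (u ++ v) ⟩
    u ++ v                    ≡⟨ cong₂ _++_ (θ∘θ⁻¹ u) (θ∘θ⁻¹ v) ⟨
    θ (θ⁻¹ u) ++ θ (θ⁻¹ v)    ≡⟨ hom (θ⁻¹ v) (θ⁻¹ u) ⟨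
    θ (θ⁻¹ v ++ θ⁻¹ u)        ∎))
    where open ≡-Reasoning

  θ⁻¹-closed : ∀ X → Invariant θ X → ∀ x → X x → X (θ⁻¹ x)
  θ⁻¹-closed X (_ , X⊆θ[X]) x x∈X =
    let v , v∈X , θv≡x = X⊆θ[X] x x∈X
    in subst X (trans (sym (θ⁻¹∘θ v)) (cong θ⁻¹ θv≡x)) v∈X

module OrbitInvariance {A : Set} (θ : List A → List A)
                       (θ-injective : Injective _≡_ _≡_ θ) (θ-surjective : Surjective _≡_ _≡_ θ)
                       (θ-literal : Literal θ) (θ-hom : IsMorphism θ ⊎ IsAntimorphism θ)
                       (X : Lang A) (X-invariant : Invariant θ X) where

  open BijectiveInverse θ θ-injective θ-surjective
  private
    module Θ = LiteralHom θ θ-literal θ-hom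
    module Θ⁻¹ = LiteralHom θ⁻¹ (θ⁻¹-literal Θ.length-φ) (θ⁻¹-hom θ-hom)

  PaddedNonFactor-θ : ∀ {m s} → PaddedNonFactor X m s → PaddedNonFactor X m (θ s)
  PaddedNonFactor-θ = Θ.PaddedNonFactor-φ X θ-injective λ w F →
    subst (Factors (Star X)) (θ⁻¹∘θ w) (Θ⁻¹.Factors-φ X (θ⁻¹-closed X X-invariant) F)

  PaddedNonFactor-θ⁻¹ : ∀ {m s} → PaddedNonFactor X m s → PaddedNonFactor X m (θ⁻¹ s)
  PaddedNonFactor-θ⁻¹ = Θ⁻¹.PaddedNonFactor-φ X θ⁻¹-injective λ w F →
    subst (Factors (Star X)) (θ∘θ⁻¹ w) (Θ.Factors-φ X (proj₁ X-invariant) F)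

  PaddedNonFactor-iter : ∀ {m z} → PaddedNonFactor X m z → ∀ k → PaddedNonFactor X m (iter θ k z)
  PaddedNonFactor-iter P zero    = P
  PaddedNonFactor-iter P (suc k) = PaddedNonFactor-θ (PaddedNonFactor-iter P k)

  PaddedNonFactor-iter⁻¹ : ∀ {m} k w → PaddedNonFactor X m (iter θ k w) → PaddedNonFactor X m w
  PaddedNonFactor-iter⁻¹ zero    w P = P
  PaddedNonFactor-iter⁻¹ (suc k) w P =
    PaddedNonFactor-iter⁻¹ k w (subst (PaddedNonFactor X _) (θ⁻¹∘θ _) (PaddedNonFactor-θ⁻¹ P))

  PaddedNonFactor-orbit : ∀ {m z w} → PaddedNonFactor X m z → Orbit θ z w → PaddedNonFactor X m w
  PaddedNonFactor-orbit P (k , inj₁ θᵏz≡w) = subst (PaddedNonFactor X _) θᵏz≡w (PaddedNonFactor-iter P k)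
  PaddedNonFactor-orbit P (k , inj₂ θᵏw≡z) = PaddedNonFactor-iter⁻¹ k _ (subst (PaddedNonFactor X _) (sym θᵏw≡z) P)

lemma3 : (A : Set) → Countable A → AtLeastTwo A →
    (θ : List A → List A) → LiteralBijectiveAntiMorphism θ →
    (X : Lang A) → Invariant θ X → IsCode X → ¬ Complete X →
    (y : List A) → ¬ Factors (Star X) y → length y ≥ 2 →
    (a a̅ : A) → head y ≡ just a → last y ≡ just a̅ → a ≢ a̅ →
    let z = replicate (length y) a̅ ++ y ++ replicate (length y) a
    in ∀ w → ¬ (PlusSurround (Orbit θ z) w × Sandwich (Orbit θ z) X w)
lemma3 _ _ _ _ _ _ _ _ _ []          _ ()
lemma3 _ _ _ _ _ _ _ _ _ (_ ∷ [])    _ (s≤s ())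
lemma3 _ _ _ θ ((θ-injective , θ-surjective) , θ-literal , θ-hom) X X-invariant _ _
       (c ∷ b ∷ rest) y∉F _ a a̅ refl last≡a̅ a≢a̅
       w ((u , s , v , u≢[] , v≢[] , s∈Z , refl) , (s₁ , x , s₂ , s₁∈Z , x∈X* , s₂∈Z , e)) =
  PaddedNonFactor-no-sandwich X (orbit s∈Z) (proj₁ (orbit s₁∈Z)) (proj₁ (orbit s₂∈Z)) u≢[] v≢[] x∈X* e
  where
  open OrbitInvariance θ θ-injective θ-surjective θ-literal θ-hom X X-invariant
  n : ℕ
  n = 2 + length rest
  z-padded : PaddedNonFactor X (length rest) (replicate n a̅ ++ (a ∷ b ∷ rest) ++ replicate n a)
  z-padded = let P , core≡y = Padded-around b rest last≡a̅ a≢a̅ in P , y∉F ∘ subst (Factors (Star X)) core≡y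
  orbit : ∀ {w} → Orbit θ _ w → PaddedNonFactor X (length rest) w
  orbit = PaddedNonFactor-orbit z-padded
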